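{- Let $y,k\in\mathbb{N}$ and let $p\ge 3$ be a prime. If $\phi(y)\le\phi(Y_{p,k})$, then $|W(y)|\le|W(Y_{p,k})|$.
   Context: $\phi$ is Euler's totient function; $W(x)$ is the set of prime divisors of $x$. For a prime $p$, $p_i$ is the $i$th smallest prime greater than $p$, and $Y_{p,k}=\prod_{q\text{ prime},\ q\le p_k,\ q\ne p}q$. -}

module Defs where

open import Data.Nat using (ℕ; zero; suc; _+_; _<_; _≤_; _≟_)
open import Data.Nat.Properties using (_<?_; _≤?_)
open import Data.Nat.Divisibility using (_∣_; _∣?_)
open import Data.Nat.Coprimality using (Coprime; coprime?)
open import Data.Nat.Primality using (Prime; prime?)
open import Data.List using (List; filter; length; upTo; map)
open import Data.Nat.ListAction using (product)
open import Data.Product using (_×_)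
open import Relation.Nullary using (¬_)
open import Relation.Nullary.Decidable using (_×-dec_; ¬?)
open import Relation.Binary.PropositionalEquality using (_≡_)

range1 : ℕ → List ℕ
range1 n = map suc (upTo n)

φ : ℕ → ℕ
φ n = length (filter (λ m → coprime? m n) (range1 n))

-- W(x): the prime divisors of x (for x ≥ 1 they all lie in [1,x])
W : ℕ → List ℕ
W x = filter (λ q → prime? q ×-dec q ∣? x) (range1 x)

primesBetween : ℕ → ℕ → ℕ
primesBetween p P = length (filter (λ q → p <? q ×-dec prime? q) (range1 P))

-- P is p_k, the k-th smallest prime greater than p (p_0 = p)
IsKthPrimeAfter : ℕ → ℕ → ℕ → Set
IsKthPrimeAfter p k P = Prime P × p ≤ P × primesBetween p P ≡ k

-- Y_{p,k} given P = p_k : product of primes q ≤ P with q ≠ p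
Y : ℕ → ℕ → ℕ
Y p P = product (filter (λ q → prime? q ×-dec ¬? (q ≟ p)) (range1 P))

-- If ω(y) > ω(Y) = π(P) − 1, then y has at least π(P) prime divisors. Since
-- φ(y) ≥ ∏_{q ∣ y} (q − 1), and trading the prime divisors of y above P for the
-- no more numerous primes up to P that do not divide y can only lower this
-- product, φ(y) ≥ ∏_{q ≤ P} (q − 1) = (p − 1) φ(Y) ≥ 2 φ(Y) > φ(Y).
module Submission where

open import Level using (0ℓ)
open import Algebra.Bundles using (CommutativeSemigroup)
open import Algebra.Structures using (IsCommutativeMonoid)
import Algebra.Properties.CommutativeSemigroup as CommutativeSemigroupProperties
open import Data.Bool using (if_then_else_)
open import Data.List using (List; []; _∷_; _++_; [_]; length; filter; foldr; map; applyUpTo)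
open import Data.List.Properties using (applyUpTo-∷ʳ; map-++; filter-++)
open import Data.List.Relation.Unary.All using (All; []; _∷_)
open import Data.Nat
  using (ℕ; zero; suc; pred; _+_; _*_; _^_; _≤_; _<_; _≤′_; ≤′-refl; ≤′-step; z≤n; s≤s; s≤s⁻¹; z<s;
         _≟_; _≤?_; NonZero; >-nonZero; >-nonZero⁻¹; nonTrivial⇒≢1)
open import Data.Nat.Properties
  using (module ≤-Reasoning; ≤-refl; ≤-trans; ≤-reflexive; <-≤-trans; <-irrefl; <⇒≱; <⇒≢; ≰⇒>; ≮⇒≥;
         ≤∧≢⇒<; ≤⇒≤′; ≤′⇒≤; m≤n⇒m≤1+n; <⇒≤pred; pred[n]≤n; m≤m+n; m≤n+m; m≤m*n; m≤n*m; m<m*n;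
         +-comm; +-suc; +-identityʳ; +-mono-≤; +-cancelˡ-≤; +-cancelˡ-≡; *-comm; *-identityʳ;
         *-mono-≤; *-monoˡ-≤; *-monoʳ-≤; ^-zeroˡ; ^-distribˡ-+-*; ^-monoʳ-≤;
         +-0-isCommutativeMonoid; *-1-isCommutativeMonoid)
open import Data.Nat.Coprimality as C using (Coprime; coprime?; coprime-divisor)
open import Data.Nat.Divisibility
  using (_∣_; _∣?_; ∣-refl; ∣-trans; ∣⇒≤; ∣1⇒≡1; ∣m+n∣m⇒∣n; ∣m∣n⇒∣m+n; m∣m*n; n∣m*n; ∣n⇒∣m*n)
open import Data.Nat.ListAction using (product)
open import Data.Nat.Primality
  using (Prime; prime?; ¬prime[0]; prime⇒nonZero; prime⇒nonTrivial; prime⇒irreducible; euclidsLemma;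
         productOfPrimes≢0)
open import Data.Nat.Primality.Factorisation using (PrimeFactorisation; factorise)
open import Data.Product using (_×_; _,_; proj₁; proj₂; swap)
open import Data.Sum using (_⊎_; inj₁; inj₂)
open import Function using (id; _∘_; _⇔_; mk⇔)
open import Relation.Binary.PropositionalEquality
  using (_≡_; _≢_; refl; sym; trans; cong; cong₂; subst; module ≡-Reasoning)
open import Relation.Nullary using (Dec; yes; no; does; ¬_; contradiction)
open import Relation.Nullary.Decidable using (_×-dec_; ¬?; dec-true; dec-false; does-⇔)
open import Relation.Unary using (Decidable)
open import Defs

private variable
  P Q : ℕ → Set

range1-suc : ∀ n → range1 (suc n) ≡ range1 n ++ [ suc n ]
range1-suc n = trans (cong (map suc) (sym (applyUpTo-∷ʳ id n))) (map-++ suc (applyUpTo id n) [ n ])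

module BigOperator {_∙_ : ℕ → ℕ → ℕ} {ε : ℕ} (isCM : IsCommutativeMonoid _≡_ _∙_ ε) where
  open IsCommutativeMonoid isCM using (assoc; identityˡ; identityʳ; isCommutativeSemigroup)

  private
    commutativeSemigroup : CommutativeSemigroup 0ℓ 0ℓ
    commutativeSemigroup = record { isCommutativeSemigroup = isCommutativeSemigroup }

  open CommutativeSemigroupProperties commutativeSemigroup using (interchange; xy∙z≈xz∙y)

  ⨁ : Decidable P → (ℕ → ℕ) → ℕ → ℕ
  ⨁ P? f zero    = ε
  ⨁ P? f (suc n) = ⨁ P? f n ∙ (if does (P? (suc n)) then f (suc n) else ε)

  module _ {P Q : ℕ → Set} {P? : Decidable P} {Q? : Decidable Q} {f : ℕ → ℕ} where

    ⨁-cong-≤ : ∀ n → (∀ {i} → i ≤ n → P i ⇔ Q i) → ⨁ P? f n ≡ ⨁ Q? f n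
    ⨁-cong-≤ zero    P⇔Q = refl
    ⨁-cong-≤ (suc n) P⇔Q = cong₂ _∙_ (⨁-cong-≤ n (P⇔Q ∘ m≤n⇒m≤1+n))
      (cong (λ b → if b then f (suc n) else ε) (does-⇔ (P⇔Q ≤-refl) (P? (suc n)) (Q? (suc n))))

    ⨁-cong : (∀ {i} → P i → Q i) → (∀ {i} → Q i → P i) → ∀ n → ⨁ P? f n ≡ ⨁ Q? f n
    ⨁-cong P⇒Q Q⇒P n = ⨁-cong-≤ n (λ _ → mk⇔ P⇒Q Q⇒P)

    ⨁-split : ∀ n →
      ⨁ P? f n ≡ ⨁ (λ i → P? i ×-dec Q? i) f n ∙ ⨁ (λ i → P? i ×-dec ¬? (Q? i)) f n
    ⨁-split zero    = sym (identityʳ ε)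
    ⨁-split (suc n) = trans (cong₂ _∙_ (⨁-split n) (term-split (P? (suc n)) (Q? (suc n))))
                            (interchange _ _ _ _)
      where
      term-split : ∀ {A B : Set} (a? : Dec A) (b? : Dec B) →
        (if does a? then f (suc n) else ε) ≡
        (if does (a? ×-dec b?) then f (suc n) else ε) ∙ (if does (a? ×-dec ¬? b?) then f (suc n) else ε)
      term-split (yes _) (yes _) = sym (identityʳ _)
      term-split (yes _) (no _)  = sym (identityˡ _)
      term-split (no _)  _       = sym (identityʳ ε)

  module _ {P : ℕ → Set} {P? : Decidable P} {f : ℕ → ℕ} where

    ⨁-empty : ∀ n → (∀ {i} → 0 < i → i ≤ n → ¬ P i) → ⨁ P? f n ≡ ε
    ⨁-empty zero    ¬P = refl
    ⨁-empty (suc n) ¬P with P? (suc n)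
    ... | yes Pn = contradiction Pn (¬P (s≤s z≤n) ≤-refl)
    ... | no _   = trans (identityʳ _) (⨁-empty n (λ 0<i i≤n → ¬P 0<i (m≤n⇒m≤1+n i≤n)))

    ⨁-extend : ∀ {m n} → m ≤ n → (∀ {i} → P i → i ≤ m) → ⨁ P? f n ≡ ⨁ P? f m
    ⨁-extend {m} m≤n P⇒≤m = go (≤⇒≤′ m≤n)
      where
      go : ∀ {n} → m ≤′ n → ⨁ P? f n ≡ ⨁ P? f m
      go ≤′-refl = refl
      go (≤′-step {n} m≤′n) with P? (suc n)
      ... | yes Pn = contradiction (P⇒≤m Pn) (<⇒≱ (s≤s (≤′⇒≤ m≤′n)))
      ... | no _   = trans (identityʳ _) (go m≤′n)

    ⨁-+ : ∀ m n → ⨁ P? f (m + n) ≡ ⨁ P? f m ∙ ⨁ (λ i → P? (m + i)) (λ i → f (m + i)) n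
    ⨁-+ m zero    = trans (cong (⨁ P? f) (+-identityʳ m)) (sym (identityʳ _))
    ⨁-+ m (suc n) rewrite +-suc m n = trans (cong (_∙ _) (⨁-+ m n)) (assoc _ _ _)

    foldr-filter-range1 : ∀ n → foldr (λ x acc → f x ∙ acc) ε (filter P? (range1 n)) ≡ ⨁ P? f n
    foldr-filter-range1 zero    = refl
    foldr-filter-range1 (suc n) = begin
      fold (filter P? (range1 (suc n)))              ≡⟨ cong (fold ∘ filter P?) (range1-suc n) ⟩
      fold (filter P? (range1 n ++ [ suc n ]))       ≡⟨ cong fold (filter-++ P? (range1 n) [ suc n ]) ⟩
      fold (filter P? (range1 n) ++ filter P? [ suc n ])
        ≡⟨ fold-++ (filter P? (range1 n)) (filter P? [ suc n ]) ⟩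
      fold (filter P? (range1 n)) ∙ fold (filter P? [ suc n ])
        ≡⟨ cong₂ _∙_ (foldr-filter-range1 n) last ⟩
      ⨁ P? f (suc n) ∎
      where
      open ≡-Reasoning
      fold : List ℕ → ℕ
      fold = foldr (λ x acc → f x ∙ acc) ε
      fold-++ : ∀ xs ys → fold (xs ++ ys) ≡ fold xs ∙ fold ys
      fold-++ []       ys = sym (identityˡ _)
      fold-++ (x ∷ xs) ys = trans (cong (f x ∙_) (fold-++ xs ys)) (sym (assoc _ _ _))
      last : fold (filter P? [ suc n ]) ≡ (if does (P? (suc n)) then f (suc n) else ε)
      last with P? (suc n)
      ... | yes _ = identityʳ _
      ... | no _  = refl

  module _ {P : ℕ → Set} {P? : Decidable P} {f : ℕ → ℕ} where

    ⨁-restrict : ∀ {m n} → m ≤ n → ⨁ (λ i → P? i ×-dec i ≤? m) f n ≡ ⨁ P? f m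
    ⨁-restrict {m} m≤n = trans (⨁-extend m≤n proj₂) (⨁-cong-≤ m (λ i≤m → mk⇔ proj₁ (_, i≤m)))

    ⨁-remove : ∀ {a} n → 0 < a → a ≤ n → P a →
               ⨁ P? f n ≡ ⨁ (λ i → P? i ×-dec ¬? (i ≟ a)) f n ∙ f a
    ⨁-remove zero    0<a a≤0 _ = contradiction a≤0 (<⇒≱ 0<a)
    ⨁-remove {a} (suc n) 0<a a≤1+n Pa with a ≟ suc n
    ... | yes refl = begin
      ⨁ P? f n ∙ (if does (P? a) then f a else ε)
        ≡⟨ cong₂ _∙_ (⨁-cong-≤ n (λ i≤n → mk⇔ (_, <⇒≢ (s≤s i≤n)) proj₁))
                     (cong (λ b → if b then f a else ε) (dec-true (P? a) Pa)) ⟩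
      ⨁ R? f n ∙ f a
        ≡⟨ cong (_∙ f a) (sym (identityʳ _)) ⟩
      (⨁ R? f n ∙ ε) ∙ f a
        ≡⟨ cong (λ b → (⨁ R? f n ∙ (if b then f a else ε)) ∙ f a)
                (sym (dec-false (R? a) (λ (_ , a≢a) → a≢a refl))) ⟩
      (⨁ R? f n ∙ (if does (R? a) then f a else ε)) ∙ f a ∎
      where
      open ≡-Reasoning
      R? = λ i → P? i ×-dec ¬? (i ≟ a)
    ... | no a≢1+n = trans
      (cong₂ _∙_ (⨁-remove n 0<a (s≤s⁻¹ (≤∧≢⇒< a≤1+n a≢1+n)) Pa)
                 (cong (λ b → if b then f (suc n) else ε)
                       (does-⇔ (mk⇔ (_, a≢1+n ∘ sym) proj₁) (P? (suc n)) (P? (suc n) ×-dec ¬? (suc n ≟ a)))))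
      (xy∙z≈xz∙y _ _ _)

module Sum  = BigOperator +-0-isCommutativeMonoid
module Prod = BigOperator *-1-isCommutativeMonoid

count : Decidable P → ℕ → ℕ
count P? = Sum.⨁ P? (λ _ → 1)

∏ : Decidable P → (ℕ → ℕ) → ℕ → ℕ
∏ = Prod.⨁

length-filter-range1 : (P? : Decidable P) → ∀ n → length (filter P? (range1 n)) ≡ count P? n
length-filter-range1 P? = Sum.foldr-filter-range1

product-filter-range1 : (P? : Decidable P) → ∀ n → product (filter P? (range1 n)) ≡ ∏ P? id n
product-filter-range1 P? = Prod.foldr-filter-range1

module _ {P? : Decidable P} {Q? : Decidable Q} where

  count-mono : (∀ {i} → P i → Q i) → ∀ n → count P? n ≤ count Q? n
  count-mono P⇒Q zero    = z≤n
  count-mono P⇒Q (suc n) = +-mono-≤ (count-mono P⇒Q n) (term-mono (P? (suc n)) (Q? (suc n)))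
    where
    term-mono : (a? : Dec (P (suc n))) (b? : Dec (Q (suc n))) →
                (if does a? then 1 else 0) ≤ (if does b? then 1 else 0)
    term-mono (yes Pn) (no ¬Qn) = contradiction (P⇒Q Pn) ¬Qn
    term-mono (yes _)  (yes _)  = ≤-refl
    term-mono (no _)   _        = z≤n

module _ {P? : Decidable P} where

  count-periodic : ∀ m → (∀ {i} → P (m + i) → P i) → (∀ {i} → P i → P (m + i)) →
                   ∀ k → count P? (k * m) ≡ k * count P? m
  count-periodic m shiftˡ shiftʳ zero    = refl
  count-periodic m shiftˡ shiftʳ (suc k) = begin
    count P? (m + k * m)                           ≡⟨ Sum.⨁-+ m (k * m) ⟩
    count P? m + count (λ i → P? (m + i)) (k * m)  ≡⟨ cong (count P? m +_) (Sum.⨁-cong shiftˡ shiftʳ (k * m)) ⟩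
    count P? m + count P? (k * m)                  ≡⟨ cong (count P? m +_) (count-periodic m shiftˡ shiftʳ k) ⟩
    count P? m + k * count P? m                    ∎
    where open ≡-Reasoning

  count-multiples : ∀ q n →
    count (λ x → P? x ×-dec suc q ∣? x) (n * suc q) ≡ count (λ t → P? (t * suc q)) n
  count-multiples q zero    = refl
  count-multiples q (suc n) = begin
    count X? (suc n * suc q)
      ≡⟨ cong (count X?) (+-comm (suc q) (n * suc q)) ⟩
    count X? (n * suc q + suc q)
      ≡⟨ Sum.⨁-+ (n * suc q) (suc q) ⟩
    count X? (n * suc q) + count (λ j → X? (n * suc q + j)) (suc q)
      ≡⟨ cong₂ _+_ (count-multiples q n) lastBlock ⟩
    count (λ t → P? (t * suc q)) (suc n) ∎
    where
    open ≡-Reasoning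
    X? = λ x → P? x ×-dec suc q ∣? x
    n*q+q≡[1+n]*q : n * suc q + suc q ≡ suc n * suc q
    n*q+q≡[1+n]*q = +-comm (n * suc q) (suc q)
    lastBlock : count (λ j → X? (n * suc q + j)) (suc q) ≡ (if does (P? (suc n * suc q)) then 1 else 0)
    lastBlock = cong₂ _+_
      (Sum.⨁-empty q λ 0<j j≤q (_ , 1+q∣) →
        <⇒≱ (s≤s j≤q) (∣⇒≤ {{>-nonZero 0<j}} (∣m+n∣m⇒∣n 1+q∣ (n∣m*n n))))
      (cong (λ b → if b then 1 else 0) (does-⇔
        (mk⇔ (subst P n*q+q≡[1+n]*q ∘ proj₁)
             (λ P[1+n]q → subst P (sym n*q+q≡[1+n]*q) P[1+n]q , ∣m∣n⇒∣m+n (n∣m*n n) ∣-refl))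
        (X? (n * suc q + suc q)) (P? (suc n * suc q))))

module _ {P? : Decidable P} {f : ℕ → ℕ} where

  ∏-≤-^count : ∀ {b} → (∀ {i} → P i → f i ≤ b) → ∀ n → ∏ P? f n ≤ b ^ count P? n
  ∏-≤-^count f≤b zero    = ≤-refl
  ∏-≤-^count {b} f≤b (suc n) with P? (suc n)
  ... | yes Pn = begin
    ∏ P? f n * f (suc n)        ≤⟨ *-mono-≤ (∏-≤-^count f≤b n) (f≤b Pn) ⟩
    b ^ count P? n * b          ≡⟨ cong (b ^ count P? n *_) (sym (*-identityʳ b)) ⟩
    b ^ count P? n * b ^ 1      ≡⟨ ^-distribˡ-+-* b (count P? n) 1 ⟨
    b ^ (count P? n + 1)        ∎
    where open ≤-Reasoning
  ... | no _ rewrite *-identityʳ (∏ P? f n) | +-identityʳ (count P? n) = ∏-≤-^count f≤b n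

  ^count-≤-∏ : ∀ {b} → (∀ {i} → P i → b ≤ f i) → ∀ n → b ^ count P? n ≤ ∏ P? f n
  ^count-≤-∏ b≤f zero    = ≤-refl
  ^count-≤-∏ {b} b≤f (suc n) with P? (suc n)
  ... | yes Pn = begin
    b ^ (count P? n + 1)        ≡⟨ ^-distribˡ-+-* b (count P? n) 1 ⟩
    b ^ count P? n * b ^ 1      ≡⟨ cong (b ^ count P? n *_) (*-identityʳ b) ⟩
    b ^ count P? n * b          ≤⟨ *-mono-≤ (^count-≤-∏ b≤f n) (b≤f Pn) ⟩
    ∏ P? f n * f (suc n)        ∎
    where open ≤-Reasoning
  ... | no _ rewrite *-identityʳ (∏ P? f n) | +-identityʳ (count P? n) = ^count-≤-∏ b≤f n

  ∣-∏ : ∀ {i} n → 0 < i → i ≤ n → P i → f i ∣ ∏ P? f n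
  ∣-∏ zero    0<i i≤0 _ = contradiction i≤0 (<⇒≱ 0<i)
  ∣-∏ {i} (suc n) 0<i i≤1+n Pi with i ≟ suc n
  ... | no i≢1+n = ∣-trans (∣-∏ n 0<i (s≤s⁻¹ (≤∧≢⇒< i≤1+n i≢1+n)) Pi) (m∣m*n _)
  ... | yes refl rewrite dec-true (P? i) Pi = n∣m*n (∏ P? f n)

prime⇒≢1 : ∀ {p} → Prime p → p ≢ 1
prime⇒≢1 p-prime = nonTrivial⇒≢1 {{prime⇒nonTrivial p-prime}}

module _ {P? : Decidable P} where

  prime∣∏⇒≤ : ∀ {r} → Prime r → ∀ n → r ∣ ∏ P? id n → r ≤ n
  prime∣∏⇒≤ r-prime zero    r∣1 = contradiction (∣1⇒≡1 r∣1) (prime⇒≢1 r-prime)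
  prime∣∏⇒≤ r-prime (suc n) r∣∏ with P? (suc n)
  ... | no _ = m≤n⇒m≤1+n (prime∣∏⇒≤ r-prime n (subst (_ ∣_) (*-identityʳ _) r∣∏))
  ... | yes _ with euclidsLemma (∏ P? id n) (suc n) r-prime r∣∏
  ...   | inj₁ r∣∏′   = m≤n⇒m≤1+n (prime∣∏⇒≤ r-prime n r∣∏′)
  ...   | inj₂ r∣1+n = ∣⇒≤ r∣1+n

module _ {S? : Decidable P} {D? : Decidable Q} {f : ℕ → ℕ} where

  ∏-exchange : ∀ b .{{_ : NonZero b}} →
               (∀ {i} → P i → ¬ Q i → f i ≤ b) → (∀ {i} → Q i → ¬ P i → b ≤ f i) →
               ∀ n → count S? n ≤ count D? n → ∏ S? f n ≤ ∏ D? f n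
  ∏-exchange b f≤b b≤f n countS≤countD = begin
    ∏ S? f n                         ≡⟨ Prod.⨁-split n ⟩
    ∏ S∧D? f n * ∏ S∖D? f n          ≤⟨ *-monoʳ-≤ (∏ S∧D? f n) (∏-≤-^count (λ (S , ¬D) → f≤b S ¬D) n) ⟩
    ∏ S∧D? f n * b ^ count S∖D? n    ≤⟨ *-monoʳ-≤ (∏ S∧D? f n) (^-monoʳ-≤ b fewer) ⟩
    ∏ S∧D? f n * b ^ count D∖S? n    ≤⟨ *-monoʳ-≤ (∏ S∧D? f n) (^count-≤-∏ (λ (D , ¬S) → b≤f D ¬S) n) ⟩
    ∏ S∧D? f n * ∏ D∖S? f n          ≡⟨ cong (_* ∏ D∖S? f n) (Prod.⨁-cong swap swap n) ⟩
    ∏ D∧S? f n * ∏ D∖S? f n          ≡⟨ Prod.⨁-split n ⟨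
    ∏ D? f n                         ∎
    where
    open ≤-Reasoning
    S∧D? = λ i → S? i ×-dec D? i
    D∧S? = λ i → D? i ×-dec S? i
    S∖D? = λ i → S? i ×-dec ¬? (D? i)
    D∖S? = λ i → D? i ×-dec ¬? (S? i)
    fewer : count S∖D? n ≤ count D∖S? n
    fewer = +-cancelˡ-≤ (count S∧D? n) _ _ (begin
      count S∧D? n + count S∖D? n    ≡⟨ Sum.⨁-split n ⟨
      count S? n                     ≤⟨ countS≤countD ⟩
      count D? n                     ≡⟨ Sum.⨁-split n ⟩
      count D∧S? n + count D∖S? n    ≡⟨ cong (_+ count D∖S? n) (Sum.⨁-cong swap swap n) ⟩
      count S∧D? n + count D∖S? n    ∎)

module _ {m : ℕ} where

  coprime-* : ∀ {a b} → Coprime m a → Coprime m b → Coprime m (a * b)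
  coprime-* {a} cma cmb (d∣m , d∣ab) = cmb (d∣m , coprime-divisor d⊥a d∣ab)
    where
    d⊥a : Coprime _ a
    d⊥a (e∣d , e∣a) = cma (∣-trans e∣d d∣m , e∣a)

  coprime-∣ : ∀ {d n} → d ∣ n → Coprime m n → Coprime m d
  coprime-∣ d∣n c (e∣m , e∣d) = c (e∣m , ∣-trans e∣d d∣n)

  coprime-+⁻¹ : ∀ {n} → Coprime (n + m) n → Coprime m n
  coprime-+⁻¹ c (d∣m , d∣n) = c (∣m∣n⇒∣m+n d∣n d∣m , d∣n)

prime∤⇒coprime : ∀ {p m} → Prime p → ¬ p ∣ m → Coprime p m
prime∤⇒coprime p-prime p∤m (d∣p , d∣m) with prime⇒irreducible p-prime d∣p
... | inj₁ d≡1  = d≡1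
... | inj₂ refl = contradiction d∣m p∤m

coprimeTo? : ∀ n → Decidable (λ m → Coprime m n)
coprimeTo? n m = coprime? m n

φ≡count : ∀ n → φ n ≡ count (coprimeTo? n) n
φ≡count n = length-filter-range1 (coprimeTo? n) n

φ-*-∣ : ∀ {q n} → q ∣ n → φ (q * n) ≡ q * φ n
φ-*-∣ {q} {n} q∣n = begin
  φ (q * n)                              ≡⟨ φ≡count (q * n) ⟩
  count (coprimeTo? (q * n)) (q * n)     ≡⟨ Sum.⨁-cong ⊥q*n⇒⊥n ⊥n⇒⊥q*n (q * n) ⟩
  count (coprimeTo? n) (q * n)           ≡⟨ count-periodic n coprime-+⁻¹ C.coprime-+ q ⟩
  q * count (coprimeTo? n) n             ≡⟨ cong (q *_) (φ≡count n) ⟨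
  q * φ n                                ∎
  where
  open ≡-Reasoning
  ⊥q*n⇒⊥n : ∀ {m} → Coprime m (q * n) → Coprime m n
  ⊥q*n⇒⊥n = coprime-∣ (n∣m*n q)
  ⊥n⇒⊥q*n : ∀ {m} → Coprime m n → Coprime m (q * n)
  ⊥n⇒⊥q*n c = coprime-* (coprime-∣ q∣n c) c

-- The residues in [1, qn] coprime to n are those coprime to qn, plus the
-- multiples tq with t ∈ [1, n] coprime to n.
φ-*-∤ : ∀ {q n} → Prime q → ¬ q ∣ n → φ (q * n) ≡ pred q * φ n
φ-*-∤ {zero}          0-prime = contradiction 0-prime ¬prime[0]
φ-*-∤ {q@(suc q′)} {n} q-prime q∤n = +-cancelˡ-≡ (φ n) (φ (q * n)) (q′ * φ n) (begin
  φ n + φ (q * n)                             ≡⟨ cong₂ _+_ φ≡count-multiples φ≡count-nonMultiples ⟩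
  count C∧Q? (q * n) + count C∖Q? (q * n)     ≡⟨ Sum.⨁-split (q * n) ⟨
  count C? (q * n)                            ≡⟨ count-periodic n coprime-+⁻¹ C.coprime-+ q ⟩
  q * count C? n                              ≡⟨ cong (q *_) (φ≡count n) ⟨
  q * φ n                                     ∎)
  where
  open ≡-Reasoning
  C? = coprimeTo? n
  C∧Q? = λ m → C? m ×-dec q ∣? m
  C∖Q? = λ m → C? m ×-dec ¬? (q ∣? m)
  q⊥n : Coprime q n
  q⊥n = prime∤⇒coprime q-prime q∤n
  ⊥n⇒q*⊥n : ∀ {t} → Coprime t n → Coprime (t * q) n
  ⊥n⇒q*⊥n c = C.sym (coprime-* (C.sym c) (C.sym q⊥n))
  q*⊥n⇒⊥n : ∀ {t} → Coprime (t * q) n → Coprime t n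
  q*⊥n⇒⊥n c = C.sym (coprime-∣ (m∣m*n q) (C.sym c))
  ⊥q*n⇒⊥n∧∤ : ∀ {m} → Coprime m (q * n) → Coprime m n × ¬ q ∣ m
  ⊥q*n⇒⊥n∧∤ c = coprime-∣ (n∣m*n q) c , λ q∣m → prime⇒≢1 q-prime (c (q∣m , m∣m*n n))
  ⊥n∧∤⇒⊥q*n : ∀ {m} → Coprime m n × ¬ q ∣ m → Coprime m (q * n)
  ⊥n∧∤⇒⊥q*n (c , q∤m) = coprime-* (C.sym (prime∤⇒coprime q-prime q∤m)) c
  φ≡count-multiples : φ n ≡ count C∧Q? (q * n)
  φ≡count-multiples = begin
    φ n                                ≡⟨ φ≡count n ⟩
    count C? n                         ≡⟨ Sum.⨁-cong ⊥n⇒q*⊥n q*⊥n⇒⊥n n ⟩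
    count (λ t → C? (t * q)) n         ≡⟨ count-multiples {P? = C?} q′ n ⟨
    count C∧Q? (n * q)                 ≡⟨ cong (count C∧Q?) (*-comm n q) ⟩
    count C∧Q? (q * n)                 ∎
  φ≡count-nonMultiples : φ (q * n) ≡ count C∖Q? (q * n)
  φ≡count-nonMultiples = trans (φ≡count (q * n)) (Sum.⨁-cong ⊥q*n⇒⊥n∧∤ ⊥n∧∤⇒⊥q*n (q * n))

φ>0 : ∀ n .{{_ : NonZero n}} → 0 < φ n
φ>0 n = subst (0 <_) (sym (trans (φ≡count n) (Sum.⨁-remove n z<s (>-nonZero⁻¹ n) (C.1-coprimeTo n))))
              (<-≤-trans z<s (m≤n+m 1 _))

module _ {P? : Decidable P} (P⇒prime : ∀ {q} → P q → Prime q) where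

  φ-∏-primes : ∀ n → φ (∏ P? id n) ≡ ∏ P? pred n
  φ-∏-primes zero    = refl
  φ-∏-primes (suc n) with P? (suc n)
  ... | no _ rewrite *-identityʳ (∏ P? id n) | *-identityʳ (∏ P? pred n) = φ-∏-primes n
  ... | yes Pn = begin
    φ (∏ P? id n * suc n)     ≡⟨ cong φ (*-comm (∏ P? id n) (suc n)) ⟩
    φ (suc n * ∏ P? id n)     ≡⟨ φ-*-∤ (P⇒prime Pn) 1+n∤∏ ⟩
    n * φ (∏ P? id n)         ≡⟨ cong (n *_) (φ-∏-primes n) ⟩
    n * ∏ P? pred n           ≡⟨ *-comm n (∏ P? pred n) ⟩
    ∏ P? pred n * n           ∎
    where
    open ≡-Reasoning
    1+n∤∏ : ¬ suc n ∣ ∏ P? id n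
    1+n∤∏ 1+n∣∏ = <-irrefl refl (prime∣∏⇒≤ (P⇒prime Pn) n 1+n∣∏)

PrimeDivisor : ℕ → ℕ → Set
PrimeDivisor y q = Prime q × q ∣ y

primeDivisor? : ∀ y → Decidable (PrimeDivisor y)
primeDivisor? y q = prime? q ×-dec q ∣? y

prime∣q*n⇒∣n⊎≡q : ∀ {q n r} → Prime q → Prime r → r ∣ q * n → r ∣ n ⊎ r ≡ q
prime∣q*n⇒∣n⊎≡q {q} {n} q-prime r-prime r∣q*n with euclidsLemma q n r-prime r∣q*n
... | inj₂ r∣n = inj₁ r∣n
... | inj₁ r∣q with prime⇒irreducible q-prime r∣q
...   | inj₁ r≡1 = contradiction r≡1 (prime⇒≢1 r-prime)
...   | inj₂ r≡q = inj₂ r≡q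

∏pred-primeDivisors≤φ-* : ∀ {q n N} .{{_ : NonZero n}} → Prime q → q * n ≤ N →
  ∏ (primeDivisor? n) pred N ≤ φ n → ∏ (primeDivisor? (q * n)) pred N ≤ φ (q * n)
∏pred-primeDivisors≤φ-* {q} {n} {N} q-prime q*n≤N IH with q ∣? n
... | yes q∣n = begin
  ∏ (primeDivisor? (q * n)) pred N    ≡⟨ Prod.⨁-cong divisor⇒ divisor⇐ N ⟩
  ∏ (primeDivisor? n) pred N          ≤⟨ IH ⟩
  φ n                                 ≤⟨ m≤n*m (φ n) q ⟩
  q * φ n                             ≡⟨ φ-*-∣ q∣n ⟨
  φ (q * n)                           ∎
  where
  open ≤-Reasoning
  instance _ = prime⇒nonZero q-prime
  divisor⇒ : ∀ {r} → PrimeDivisor (q * n) r → PrimeDivisor n r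
  divisor⇒ (r-prime , r∣q*n) with prime∣q*n⇒∣n⊎≡q q-prime r-prime r∣q*n
  ... | inj₁ r∣n = r-prime , r∣n
  ... | inj₂ refl = r-prime , q∣n
  divisor⇐ : ∀ {r} → PrimeDivisor n r → PrimeDivisor (q * n) r
  divisor⇐ (r-prime , r∣n) = r-prime , ∣n⇒∣m*n q r∣n
... | no q∤n = begin
  ∏ (primeDivisor? (q * n)) pred N    ≡⟨ Prod.⨁-remove N (>-nonZero⁻¹ q) q≤N (q-prime , m∣m*n n) ⟩
  ∏ R? pred N * pred q                ≡⟨ cong (_* pred q) (Prod.⨁-cong divisor⇒ divisor⇐ N) ⟩
  ∏ (primeDivisor? n) pred N * pred q ≤⟨ *-monoˡ-≤ (pred q) IH ⟩
  φ n * pred q                        ≡⟨ *-comm (φ n) (pred q) ⟩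
  pred q * φ n                        ≡⟨ φ-*-∤ q-prime q∤n ⟨
  φ (q * n)                           ∎
  where
  open ≤-Reasoning
  instance _ = prime⇒nonZero q-prime
  q≤N = ≤-trans (m≤m*n q n) q*n≤N
  R? = λ r → primeDivisor? (q * n) r ×-dec ¬? (r ≟ q)
  divisor⇒ : ∀ {r} → PrimeDivisor (q * n) r × r ≢ q → PrimeDivisor n r
  divisor⇒ ((r-prime , r∣q*n) , r≢q) with prime∣q*n⇒∣n⊎≡q q-prime r-prime r∣q*n
  ... | inj₁ r∣n = r-prime , r∣n
  ... | inj₂ r≡q = contradiction r≡q r≢q
  divisor⇐ : ∀ {r} → PrimeDivisor n r → PrimeDivisor (q * n) r × r ≢ q
  divisor⇐ (r-prime , r∣n) = (r-prime , ∣n⇒∣m*n q r∣n) , λ { refl → q∤n r∣n }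

∏pred-primeDivisors≤φ : ∀ y .{{_ : NonZero y}} {N} → y ≤ N → ∏ (primeDivisor? y) pred N ≤ φ y
∏pred-primeDivisors≤φ y {N} =
  subst (λ y → y ≤ N → ∏ (primeDivisor? y) pred N ≤ φ y) (sym isFactorisation) (go factorsPrime)
  where
  open PrimeFactorisation (factorise y)
  go : ∀ {fs} → All Prime fs → product fs ≤ N → ∏ (primeDivisor? (product fs)) pred N ≤ φ (product fs)
  go []                   _     = ≤-reflexive (Prod.⨁-empty N λ _ _ (r-prime , r∣1) → prime⇒≢1 r-prime (∣1⇒≡1 r∣1))
  go (q-prime ∷ fs-prime) q*n≤N = ∏pred-primeDivisors≤φ-* {{productOfPrimes≢0 fs-prime}} q-prime q*n≤N
    (go fs-prime (≤-trans (m≤n*m _ _ {{prime⇒nonZero q-prime}}) q*n≤N))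

∏pred-primes≤φ : ∀ m .{{_ : NonZero m}} y .{{_ : NonZero y}} →
                 count prime? m ≤ length (W y) → ∏ prime? pred m ≤ φ y
∏pred-primes≤φ m y π[m]≤ω[y] = begin
  ∏ prime? pred m                   ≡⟨ Prod.⨁-restrict m≤N ⟨
  ∏ S? pred N                       ≤⟨ ∏-exchange m small large N fewer ⟩
  ∏ (primeDivisor? y) pred N        ≤⟨ ∏pred-primeDivisors≤φ y y≤N ⟩
  φ y                               ∎
  where
  open ≤-Reasoning
  N = m + y
  m≤N = m≤m+n m y
  y≤N = m≤n+m y m
  S? = λ q → prime? q ×-dec q ≤? m
  small : ∀ {q} → Prime q × q ≤ m → ¬ PrimeDivisor y q → pred q ≤ m
  small (_ , q≤m) _ = ≤-trans pred[n]≤n q≤m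
  large : ∀ {q} → PrimeDivisor y q → ¬ (Prime q × q ≤ m) → m ≤ pred q
  large (q-prime , _) ¬S = <⇒≤pred (≰⇒> (λ q≤m → ¬S (q-prime , q≤m)))
  fewer : count S? N ≤ count (primeDivisor? y) N
  fewer = begin
    count S? N                     ≡⟨ Sum.⨁-restrict m≤N ⟩
    count prime? m                 ≤⟨ π[m]≤ω[y] ⟩
    length (W y)                   ≡⟨ length-filter-range1 (primeDivisor? y) y ⟩
    count (primeDivisor? y) y      ≡⟨ Sum.⨁-extend y≤N (λ (_ , q∣y) → ∣⇒≤ q∣y) ⟨
    count (primeDivisor? y) N      ∎

module _ {p P : ℕ} (p-prime : Prime p) (p≤P : p ≤ P) where
  private
    instance _ = prime⇒nonZero p-prime
    instance _ = >-nonZero (<-≤-trans (>-nonZero⁻¹ p) p≤P)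

    Q? : Decidable (λ q → Prime q × q ≢ p)
    Q? q = prime? q ×-dec ¬? (q ≟ p)

    Y≡∏ : Y p P ≡ ∏ Q? id P
    Y≡∏ = product-filter-range1 Q? P

    0<Y : 0 < Y p P
    0<Y = subst (0 <_) (sym Y≡∏) (subst (_≤ ∏ Q? id P) (^-zeroˡ (count Q? P))
            (^count-≤-∏ (λ (q-prime , _) → >-nonZero⁻¹ _ {{prime⇒nonZero q-prime}}) P))

    instance _ = >-nonZero 0<Y
    instance _ = >-nonZero (φ>0 (Y p P))

    count-Q≤ω[Y] : count Q? P ≤ length (W (Y p P))
    count-Q≤ω[Y] = begin
      count Q? P                         ≡⟨ Sum.⨁-restrict (m≤m+n P (Y p P)) ⟨
      count (λ q → Q? q ×-dec q ≤? P) N  ≤⟨ count-mono Q⇒divisor N ⟩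
      count (primeDivisor? (Y p P)) N    ≡⟨ Sum.⨁-extend (m≤n+m (Y p P) P) (λ (_ , q∣Y) → ∣⇒≤ q∣Y) ⟩
      count (primeDivisor? (Y p P)) (Y p P) ≡⟨ length-filter-range1 (primeDivisor? (Y p P)) (Y p P) ⟨
      length (W (Y p P))                 ∎
      where
      open ≤-Reasoning
      N = P + Y p P
      Q⇒divisor : ∀ {q} → (Prime q × q ≢ p) × q ≤ P → PrimeDivisor (Y p P) q
      Q⇒divisor (Qq@(q-prime , _) , q≤P) =
        q-prime , subst (_ ∣_) (sym Y≡∏) (∣-∏ P (>-nonZero⁻¹ _ {{prime⇒nonZero q-prime}}) q≤P Qq)

  φ[Y]<φ : ∀ y .{{_ : NonZero y}} → 2 < p → length (W (Y p P)) < length (W y) → φ (Y p P) < φ y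
  φ[Y]<φ y 2<p ω[Y]<ω[y] = begin-strict
    φ (Y p P)                       <⟨ m<m*n (φ (Y p P)) (pred p) (<⇒≤pred 2<p) ⟩
    φ (Y p P) * pred p              ≡⟨ cong (λ Y → φ Y * pred p) Y≡∏ ⟩
    φ (∏ Q? id P) * pred p          ≡⟨ cong (_* pred p) (φ-∏-primes proj₁ P) ⟩
    ∏ Q? pred P * pred p            ≡⟨ Prod.⨁-remove P (>-nonZero⁻¹ p) p≤P p-prime ⟨
    ∏ prime? pred P                 ≤⟨ ∏pred-primes≤φ P y π[P]≤ω[y] ⟩
    φ y                             ∎
    where
    open ≤-Reasoning
    π[P]≤ω[y] : count prime? P ≤ length (W y)
    π[P]≤ω[y] = begin
      count prime? P                ≡⟨ Sum.⨁-remove P (>-nonZero⁻¹ p) p≤P p-prime ⟩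
      count Q? P + 1                ≡⟨ +-comm (count Q? P) 1 ⟩
      suc (count Q? P)              ≤⟨ s≤s count-Q≤ω[Y] ⟩
      suc (length (W (Y p P)))      ≤⟨ ω[Y]<ω[y] ⟩
      length (W y)                  ∎

lemma9 : (y k p P : ℕ) → 0 < y → Prime p → 3 ≤ p → IsKthPrimeAfter p k P →
         φ y ≤ φ (Y p P) → length (W y) ≤ length (W (Y p P))
lemma9 y k p P 0<y p-prime 3≤p (_ , p≤P , _) φy≤φY =
  ≮⇒≥ λ ω[Y]<ω[y] → <⇒≱ (φ[Y]<φ p-prime p≤P y {{>-nonZero 0<y}} 3≤p ω[Y]<ω[y]) φy≤φY
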